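{- Let $\pi$ be an (untyped) $\mathbf{mL^4}$ proof net. Then the relation $\preceq^{\mathbf L}$ on the boxes of $\pi$ is a partial order, and it is upward-arborescent: for each box $\mathcal C$ there is at most one box $\mathcal B$ with $\mathcal B\prec^{\mathbf L}_1\mathcal C$.
   Context: Untyped meLL proof nets: graphs of links axiom, cut, tensor, par, for all, exists, paragraph, of course, flat, pax, why not, with exponential boxes (of course principal port, pax auxiliary ports; boxes disjoint or nested), satisfying the Danos–Regnier acyclicity criterion recursively in boxes. An indexing is a map from edges to $\mathbb Z$ such that axiom conclusions, cut premises and premises/conclusion of tensor, par, quantifier, pax and why not links have equal index, the premise of an of course, paragraph or flat link has index one more than its conclusion, and all conclusions have equal index; $\mathbf{mL^3}$ = proof nets admitting one; $\mathbf{mL^4}$ = $\mathbf{mL^3}$ proof nets in which every box has at most one auxiliary port and every exponential branch (path from a flat link through pax links to a why not link) crosses at most one auxiliary port. The level of a box is the canonical index (unique indexing $\ge0$ vanishing on some edge of each component) of its principal port's conclusion. For boxes $\mathcal B,\mathcal C$: $\mathcal B\prec_1\mathcal C$ iff same level, the principal port of $\mathcal B$ is cut with a why not link $w$, and $\mathcal C$ contains a flat link whose exponential branch ends in $w$; $\mathcal B\prec_1^{\mathbf L}\mathcal C$ iff $\mathcal B\prec_1\mathcal C$ and $\mathcal B$ is not contained in $\mathcal C$; $\preceq^{\mathbf L}$ is the reflexive-transitive closure of $\prec_1^{\mathbf L}$. -}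

module Defs where

open import Data.Nat using (ℕ; _≤_)
open import Data.Integer as ℤ using (ℤ; +_; _+_)
open import Data.Fin using (Fin)
open import Data.List using (List; []; _∷_; length)
open import Data.List.Membership.Propositional using (_∈_)
open import Data.List.Relation.Unary.All using (All)
open import Data.List.Relation.Unary.Unique.Propositional using (Unique)
open import Data.Maybe using (Maybe; just; nothing; maybe)
open import Data.Product using (Σ; ∃; ∃₂; _×_; _,_)
open import Data.Sum using (_⊎_; inj₁; inj₂)
open import Data.Bool using (Bool; true)
open import Relation.Nullary using (¬_)
open import Data.Empty using (⊥)
open import Relation.Binary.PropositionalEquality using (_≡_; _≢_)
open import Relation.Binary.Construct.Closure.ReflexiveTransitive using (Star)

-- Links of untyped meLL proof structures, over a set E of edges.
-- Each constructor lists the premises first, then the conclusion(s).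

data Link (E : Set) : Set where
  ax      : E → E → Link E
  cut     : E → E → Link E
  tensor  : E → E → E → Link E
  par     : E → E → E → Link E
  all     : E → E → Link E
  ex      : E → E → Link E
  parag   : E → E → Link E
  ofc     : E → E → Link E          -- of course (principal port of a box)
  flat    : E → E → Link E
  pax     : E → E → Link E          -- auxiliary port of a box
  whynot  : List E → E → Link E

module _ {E : Set} where

  prem : Link E → List E
  prem (ax a b)       = []
  prem (cut a b)      = a ∷ b ∷ []
  prem (tensor a b c) = a ∷ b ∷ []
  prem (par a b c)    = a ∷ b ∷ []
  prem (all a c)      = a ∷ []
  prem (ex a c)       = a ∷ []
  prem (parag a c)    = a ∷ []
  prem (ofc a c)      = a ∷ []
  prem (flat a c)     = a ∷ []
  prem (pax a c)      = a ∷ []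
  prem (whynot es c)  = es

  concl : Link E → List E
  concl (ax a b)       = a ∷ b ∷ []
  concl (cut a b)      = []
  concl (tensor a b c) = c ∷ []
  concl (par a b c)    = c ∷ []
  concl (all a c)      = c ∷ []
  concl (ex a c)       = c ∷ []
  concl (parag a c)    = c ∷ []
  concl (ofc a c)      = c ∷ []
  concl (flat a c)     = c ∷ []
  concl (pax a c)      = c ∷ []
  concl (whynot es c)  = c ∷ []

  data IsOfCourse : Link E → Set where
    isOfc : ∀ {a c} → IsOfCourse (ofc a c)

  data IsPax : Link E → Set where
    isPax : ∀ {a c} → IsPax (pax a c)

  data IsFlat : Link E → Set where
    isFlat : ∀ {a c} → IsFlat (flat a c)

  -- links switched in the Danos–Regnier criterion (keep one premise)
  data Switched : Link E → Set where
    swPar    : ∀ {a b c} → Switched (par a b c)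
    swWhyNot : ∀ {es c} → Switched (whynot es c)

-- Walks in an undirected multigraph given by a step relation
-- (step e u v : edge e joins u and v).  Acyclic = no closed trail
-- (walk with pairwise distinct edges) of positive length.

module _ {E V : Set} (step : E → V → V → Set) where

  data Walk : V → V → List E → Set where
    []  : ∀ {v} → Walk v v []
    _∷_ : ∀ {u v w e es} → step e u v → Walk v w es → Walk u w (e ∷ es)

  Acyclic : Set
  Acyclic = ∀ v e es → Walk v v (e ∷ es) → ¬ Unique (e ∷ es)

record PreStructure : Set where
  field
    nE nL nB : ℕ
    link   : Fin nL → Link (Fin nE)
    src    : Fin nE → Fin nL           -- link of which e is a conclusion
    tgt    : Fin nE → Maybe (Fin nL)   -- link of which e is a premise
                                        -- (nothing = conclusion of the net)
    bang    : Fin nB → Fin nL          -- principal port of a box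
    portBox : Fin nL → Maybe (Fin nB)  -- box of which l is a port
    inside  : Fin nB → Fin nL → Bool   -- content of a box (ports excluded)

module _ (π : PreStructure) where
  open PreStructure π

  In : Fin nB → Fin nL → Set
  In B l = inside B l ≡ true

  Port : Fin nB → Fin nL → Set
  Port B l = portBox l ≡ just B

  Aux : Fin nB → Fin nL → Set
  Aux B l = Port B l × IsPax (link l)

  InOrPort : Fin nB → Fin nL → Set
  InOrPort B l = In B l ⊎ Port B l

  _⊆ᴮ_ : Fin nB → Fin nB → Set
  B ⊆ᴮ C = ∀ l → InOrPort B l → In C l

  DisjointBoxes : Fin nB → Fin nB → Set
  DisjointBoxes B C = ∀ l → InOrPort B l → InOrPort C l → ⊥

  record WellFormed : Set where
    field
      src-spec : ∀ e l → (src e ≡ l → e ∈ concl (link l)) × (e ∈ concl (link l) → src e ≡ l)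
      tgt-spec : ∀ e l → (tgt e ≡ just l → e ∈ prem (link l)) × (e ∈ prem (link l) → tgt e ≡ just l)
      concl-unique : ∀ l → Unique (concl (link l))
      prem-unique  : ∀ l → Unique (prem (link l))
      bang-ofc   : ∀ B → IsOfCourse (link (bang B))
      ofc-bang   : ∀ l → IsOfCourse (link l) → ∃ λ B → bang B ≡ l
      bang-port  : ∀ B → Port B (bang B)
      port-kind  : ∀ B l → Port B l → l ≡ bang B ⊎ IsPax (link l)
      pax-port   : ∀ l → IsPax (link l) → ∃ λ B → Port B l
      port-out   : ∀ B l → Port B l → ¬ In B l
      port-prem  : ∀ B l e → Port B l → e ∈ prem (link l) → In B (src e)
      box-out    : ∀ B e → In B (src e) → ∃ λ l → tgt e ≡ just l × InOrPort B l
      box-in     : ∀ B e l → tgt e ≡ just l → In B l → In B (src e)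
      nesting    : ∀ B C → B ≢ C → DisjointBoxes B C ⊎ (B ⊆ᴮ C) ⊎ (C ⊆ᴮ B)

  -- Danos–Regnier acyclicity, recursively in boxes.
  -- A "level" X is either the top level (nothing) or the inside of box B.
  -- The links at level X are those whose innermost enclosing box is X
  -- (ports of immediate sub-boxes of X are at level X).  In the graph of
  -- level X every immediate sub-box is collapsed into one node.

  AtLevel : Maybe (Fin nB) → Fin nL → Set
  AtLevel nothing  l = ∀ C → ¬ In C l
  AtLevel (just B) l = In B l × (∀ C → In C l → C ≡ B ⊎ In C (bang B))

  Node : Set
  Node = Fin nL ⊎ Fin nB

  rep : Fin nL → Node
  rep l = maybe inj₂ (inj₁ l) (portBox l)

  ValidSwitching : (Fin nE → Bool) → Set
  ValidSwitching kept = ∀ l → Switched (link l) →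
      ((∃ λ e → e ∈ prem (link l)) → ∃ λ e → e ∈ prem (link l) × kept e ≡ true)
    × (∀ e e' → e ∈ prem (link l) → e' ∈ prem (link l) → kept e ≡ true → kept e' ≡ true → e ≡ e')

  LevelStep : Maybe (Fin nB) → (Fin nE → Bool) → Fin nE → Node → Node → Set
  LevelStep X kept e u v = Σ (Fin nL) λ l →
      tgt e ≡ just l × AtLevel X (src e) × AtLevel X l
    × (Switched (link l) → kept e ≡ true)
    × ((rep (src e) ≡ u × rep l ≡ v) ⊎ (rep (src e) ≡ v × rep l ≡ u))

  DanosRegnier : Set
  DanosRegnier = ∀ X kept → ValidSwitching kept → Acyclic (LevelStep X kept)

  IsProofNet : Set
  IsProofNet = WellFormed × DanosRegnier

  LinkIndexing : (Fin nE → ℤ) → Link (Fin nE) → Set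
  LinkIndexing I (ax a b)       = I a ≡ I b
  LinkIndexing I (cut a b)      = I a ≡ I b
  LinkIndexing I (tensor a b c) = I a ≡ I c × I b ≡ I c
  LinkIndexing I (par a b c)    = I a ≡ I c × I b ≡ I c
  LinkIndexing I (all a c)      = I a ≡ I c
  LinkIndexing I (ex a c)       = I a ≡ I c
  LinkIndexing I (parag a c)    = I a ≡ I c + + 1
  LinkIndexing I (ofc a c)      = I a ≡ I c + + 1
  LinkIndexing I (flat a c)     = I a ≡ I c + + 1
  LinkIndexing I (pax a c)      = I a ≡ I c
  LinkIndexing I (whynot es c)  = All (λ e → I e ≡ I c) es

  Indexing : (Fin nE → ℤ) → Set
  Indexing I = (∀ l → LinkIndexing I (link l))
             × (∀ e e' → tgt e ≡ nothing → tgt e' ≡ nothing → I e ≡ I e')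

  -- underlying undirected graph of the structure (links as vertices)
  LinkStep : Fin nE → Fin nL → Fin nL → Set
  LinkStep e u v = (src e ≡ u × tgt e ≡ just v) ⊎ (src e ≡ v × tgt e ≡ just u)

  SameComponent : Fin nE → Fin nE → Set
  SameComponent e e' = ∃ λ es → Walk LinkStep (src e) (src e') es

  Canonical : (Fin nE → ℤ) → Set
  Canonical I = Indexing I
              × (∀ e → + 0 ℤ.≤ I e)
              × (∀ e → ∃ λ e' → SameComponent e e' × I e' ≡ + 0)

  -- exponential branch: path from edge e through pax links ps to why not w
  data Branch : Fin nE → Fin nL → List (Fin nL) → Set where
    reach   : ∀ {e w es c} → tgt e ≡ just w → link w ≡ whynot es c → Branch e w []
    through : ∀ {e w p c ps} → tgt e ≡ just p → link p ≡ pax e c →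
              Branch c w ps → Branch e w (p ∷ ps)

  ExpBranch : Fin nL → Fin nL → List (Fin nL) → Set
  ExpBranch f w ps = ∃₂ λ a c → link f ≡ flat a c × Branch c w ps

  mL³ : Set
  mL³ = IsProofNet × ∃ λ I → Indexing I

  mL⁴ : Set
  mL⁴ = mL³
      × (∀ B l l' → Aux B l → Aux B l' → l ≡ l')
      × (∀ f w ps → ExpBranch f w ps → length ps ≤ 1)

  PrincipalConcl : Fin nB → Fin nE → Set
  PrincipalConcl B c = ∃ λ a → link (bang B) ≡ ofc a c

  SameLevel : Fin nB → Fin nB → Set
  SameLevel B C = ∃ λ I → Canonical I ×
    (∀ c c' → PrincipalConcl B c → PrincipalConcl C c' → I c ≡ I c')

  CutWithWhyNot : Fin nB → Fin nL → Set
  CutWithWhyNot B w = ∃₂ λ c c' → PrincipalConcl B c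
    × (∃ λ es → link w ≡ whynot es c')
    × (∃ λ k → link k ≡ cut c c' ⊎ link k ≡ cut c' c)

  _≺₁_ : Fin nB → Fin nB → Set
  B ≺₁ C = SameLevel B C × ∃ λ w → CutWithWhyNot B w
         × ∃₂ λ f ps → In C f × ExpBranch f w ps

  _≺₁ᴸ_ : Fin nB → Fin nB → Set
  B ≺₁ᴸ C = B ≺₁ C × ¬ In C (bang B)

  _⪯ᴸ_ : Fin nB → Fin nB → Set
  _⪯ᴸ_ = Star _≺₁ᴸ_

-- A step B ≺₁ᴸ C leaves a trace in the net: the principal conclusion c of
-- B is cut (cut link k) against the conclusion c' of a why-not link w, and
-- a flat link inside C reaches w by an exponential branch.  Since w lies
-- outside C and the branch crosses at most one pax link, the branch leaves
-- C through a pax port p of C whose conclusion e is a premise of w.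
--
-- Arborescence: p is the unique auxiliary port of C, so e, w and finally B
-- are determined by C.
--
-- Partial order: ⪯ᴸ is reflexive and transitive by construction; for
-- antisymmetry we show ≺₁ᴸ has no cycle.  A cycle can be shortened to one
-- through pairwise distinct boxes.  All links of the traces lie in the same
-- boxes as the principal port of the first box, hence at one level X of
-- the Danos–Regnier criterion, and the traces glue into a closed trail
-- B₀ –c– k –c'– w –e– B₁ – ⋯ – B₀ in the graph of X (boxes collapsed to
-- nodes) for a switching that keeps each e at its why-not link.  Its edges
-- are pairwise distinct because each edge determines the box it starts
-- from, contradicting the acyclicity of that level.

module Submission where

open import Defs
open import Level using (0ℓ)
open import Data.Fin using (Fin; _≟_)
open import Data.Fin.Subset using (Subset; _⊂_) renaming (_∈_ to _∈ˢ_)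
open import Data.Fin.Subset.Induction using (⊂-wellFounded)
open import Data.Fin.Properties using (any?)
open import Data.Nat using (_≤_; s≤s)
open import Data.Bool using (Bool; true)
import Data.Bool.Properties as Bool
open import Data.List using (List; []; _∷_; _++_; map; length; head)
open import Data.List.Membership.Propositional using (_∈_; _∉_)
open import Data.List.Membership.Propositional.Properties using (∈-map⁺; ∈-++⁻)
open import Data.List.Relation.Unary.Any using (here; there)
open import Data.List.Relation.Unary.All using ([]; _∷_)
import Data.List.Relation.Unary.All as All
open import Data.List.Relation.Unary.Unique.Propositional using (Unique; []; _∷_)
open import Data.List.Relation.Unary.All.Properties using (¬Any⇒All¬)
open import Data.List.Relation.Unary.Unique.Propositional.Properties using (++⁺)
import Data.List.Membership.DecPropositional as DecMembership
open import Data.Maybe using (Maybe; just; nothing; maybe; _>>=_)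
open import Data.Maybe.Properties using (just-injective)
import Data.Maybe.Properties as Maybe
open import Data.Vec using (tabulate)
open import Data.Vec.Properties using (lookup∘tabulate; lookup⇒[]=; []=⇒lookup)
open import Data.Product using (Σ; ∃; ∃₂; _×_; _,_; proj₁; proj₂)
open import Data.Sum using (_⊎_; inj₁; inj₂)
open import Data.Empty using (⊥; ⊥-elim)
open import Function using (_on_)
open import Function.Bundles using (_⇔_; mk⇔; Equivalence)
open import Function.Properties.Equivalence using (⇔-isEquivalence)
open import Induction.WellFounded using (WellFounded; Acc; acc)
import Relation.Binary.Construct.On as On
open import Relation.Binary.Core using (Rel)
open import Relation.Binary.Definitions using (DecidableEquality)
open import Relation.Binary.Structures using (IsPartialOrder; IsEquivalence)
open import Relation.Binary.PropositionalEquality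
  using (_≡_; _≢_; refl; sym; trans; cong; subst; isEquivalence)
open import Relation.Binary.Construct.Closure.ReflexiveTransitive using (Star; ε; _◅_; _◅◅_)
open import Relation.Nullary using (¬_; Dec; yes; no; does; ¬?)
open import Relation.Nullary.Decidable using (_×-dec_; dec-true)

does-true⇒ : ∀ {A : Set} (a? : Dec A) → does a? ≡ true → A
does-true⇒ (yes a) _ = a

head-∈ : ∀ {A : Set} {x : A} {xs : List A} → x ∈ xs → ∃ λ y → head xs ≡ just y × y ∈ xs
head-∈ {xs = y ∷ _} _ = y , refl , here refl

module SimplePaths {A : Set} (_≟ᴬ_ : DecidableEquality A) (R : Rel A 0ℓ) where

  open DecMembership _≟ᴬ_ using (_∈?_)

  sources : ∀ {x y} → Star R x y → List A
  sources ε = []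
  sources (_◅_ {x} _ P) = x ∷ sources P

  Simple : ∀ {x y} → Star R x y → Set
  Simple {y = y} P = Unique (sources P) × y ∉ sources P

  suffixFrom : ∀ {x y z} (P : Star R x z) → y ∈ sources P → Simple P → Σ (Star R y z) Simple
  suffixFrom (r ◅ P) (here refl) simple = r ◅ P , simple
  suffixFrom (r ◅ P) (there y∈P) (_ ∷ unique , z∉P) = suffixFrom P y∈P (unique , λ z∈ → z∉P (there z∈))

  -- cut out loops: if the first vertex recurs, continue from its last visit
  simplePath : ∀ {x y} → Star R x y → Σ (Star R x y) Simple
  simplePath ε = ε , [] , λ ()
  simplePath {x} {y} (r ◅ P) with simplePath P
  ... | Q , unique , y∉Q with x ∈? sources Q
  ...   | yes x∈Q = suffixFrom Q x∈Q (unique , y∉Q)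
  ...   | no x∉Q with x ≟ᴬ y
  ...     | yes refl = ε , [] , λ ()
  ...     | no x≢y = r ◅ Q , ¬Any⇒All¬ (sources Q) x∉Q ∷ unique
                     , λ { (here y≡x) → x≢y (sym y≡x) ; (there y∈Q) → y∉Q y∈Q }

  simpleCycle : ∀ {x y} (r : R x y) → Star R y x → Σ (Star R y x) λ Q → Unique (sources (r ◅ Q))
  simpleCycle r P with simplePath P
  ... | Q , unique , x∉Q = Q , ¬Any⇒All¬ (sources Q) x∉Q ∷ unique

module _ {E : Set} where

  whynot-concl : ∀ {es es' : List E} {c c'} → whynot es c ≡ whynot es' c' → c ≡ c'
  whynot-concl refl = refl

  pax-concl : ∀ {a a' c c' : E} → pax a c ≡ pax a' c' → c ≡ c'
  pax-concl refl = refl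

  cut-partner : ∀ {l : Link E} {x x' y} → l ≡ cut x y ⊎ l ≡ cut y x → l ≡ cut x' y ⊎ l ≡ cut y x' → x ≡ x'
  cut-partner (inj₁ refl) (inj₁ refl) = refl
  cut-partner (inj₁ refl) (inj₂ refl) = refl
  cut-partner (inj₂ refl) (inj₁ refl) = refl
  cut-partner (inj₂ refl) (inj₂ refl) = refl

module ProofStructure (π : PreStructure) (wf : WellFormed π) where
  open PreStructure π
  open WellFormed wf

  Box : Set
  Box = Fin nB

  Lk : Set
  Lk = Fin nL

  Edge : Set
  Edge = Fin nE

  srcOf : ∀ {l e} {x : Link Edge} → link l ≡ x → e ∈ concl x → src e ≡ l
  srcOf {l} {e} lx e∈ = proj₂ (src-spec e l) (subst (λ y → e ∈ concl y) (sym lx) e∈)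

  prem⇒tgt : ∀ {l e} → e ∈ prem (link l) → tgt e ≡ just l
  prem⇒tgt {l} {e} = proj₂ (tgt-spec e l)

  tgt⇒prem : ∀ {l e} → tgt e ≡ just l → e ∈ prem (link l)
  tgt⇒prem {l} {e} = proj₁ (tgt-spec e l)

  tgtOf : ∀ {l e} {x : Link Edge} → link l ≡ x → e ∈ prem x → tgt e ≡ just l
  tgtOf lx e∈ = prem⇒tgt (subst (λ y → _ ∈ prem y) (sym lx) e∈)

  bang-injective : ∀ {B B'} → bang B ≡ bang B' → B ≡ B'
  bang-injective {B} {B'} eq =
    just-injective (trans (sym (bang-port B)) (subst (λ l → portBox l ≡ just B') (sym eq) (bang-port B')))

  shape-apart : ∀ {x y l l'} {X Y : Link Edge} → src x ≡ l → src y ≡ l' →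
                link l ≡ X → link l' ≡ Y → X ≢ Y → x ≢ y
  shape-apart sx sy lx ly X≢Y refl = X≢Y (trans (sym lx) (trans (cong link (trans (sym sx) sy)) ly))

  notPort : ∀ {D l} {x : Link Edge} → link l ≡ x → ¬ IsOfCourse x → ¬ IsPax x → ¬ Port π D l
  notPort {D} lx notOfc notPax port with port-kind D _ port
  ... | inj₁ refl = notOfc (subst IsOfCourse lx (bang-ofc D))
  ... | inj₂ isPax′ = notPax (subst IsPax lx isPax′)

  boxOut : ∀ {C e l} → In π C (src e) → tgt e ≡ just l → InOrPort π C l
  boxOut {C} {e} inC te with box-out C e inC
  ... | l' , te' , io = subst (InOrPort π C) (just-injective (trans (sym te') te)) io

  SameBoxes : Lk → Lk → Set
  SameBoxes l l' = ∀ D → In π D l ⇔ In π D l'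

  private module ⇔ = IsEquivalence (⇔-isEquivalence {0ℓ})

  sameBoxes-refl : ∀ {l} → SameBoxes l l
  sameBoxes-refl D = ⇔.refl

  sameBoxes-trans : ∀ {l l' l''} → SameBoxes l l' → SameBoxes l' l'' → SameBoxes l l''
  sameBoxes-trans s t D = ⇔.trans (s D) (t D)

  sameBoxes-sym : ∀ {l l'} → SameBoxes l l' → SameBoxes l' l
  sameBoxes-sym s D = ⇔.sym (s D)

  sameAlongEdge : ∀ {e l} → tgt e ≡ just l → (∀ D → ¬ Port π D l) → SameBoxes (src e) l
  sameAlongEdge {e} {l} te notPortL D = mk⇔ into (box-in D e l te)
    where
      into : In π D (src e) → In π D l
      into inD with boxOut inD te
      ... | inj₁ inL = inL
      ... | inj₂ portL = ⊥-elim (notPortL D portL)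

  samePorts : ∀ {C l l'} → Port π C l → Port π C l' → SameBoxes l l'
  samePorts portL portL' D = mk⇔ (portsShareBoxes portL portL') (portsShareBoxes portL' portL)
    where
      portsShareBoxes : ∀ {C l l'} → Port π C l → Port π C l' → In π D l → In π D l'
      portsShareBoxes {C} {l} {l'} pl pl' inD with D ≟ C
      ... | yes refl = ⊥-elim (port-out D l pl inD)
      ... | no D≢C with nesting D C D≢C
      ...   | inj₁ disjoint = ⊥-elim (disjoint l (inj₁ inD) (inj₂ pl))
      ...   | inj₂ (inj₁ D⊆C) = ⊥-elim (port-out C l pl (D⊆C l (inj₁ inD)))
      ...   | inj₂ (inj₂ C⊆D) = C⊆D l' (inj₂ pl')

  atLevel-resp : ∀ X {l l'} → SameBoxes l l' → AtLevel π X l → AtLevel π X l'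
  atLevel-resp nothing s notIn C inC = notIn C (Equivalence.from (s C) inC)
  atLevel-resp (just B) s (inB , inner) =
    Equivalence.to (s B) inB , λ C inC → inner C (Equivalence.from (s C) inC)

  -- Every link lies at some level: the innermost box containing it, or
  -- the top level.  Found by well-founded descent along proper sub-boxes.

  contents : Box → Subset nL
  contents D = tabulate (inside D)

  _⊏_ : Box → Box → Set
  _⊏_ = _⊂_ on contents

  ⊏-wellFounded : WellFounded _⊏_
  ⊏-wellFounded = On.wellFounded contents ⊂-wellFounded

  -- a box contained in D is strictly smaller: D contains its principal port
  properSubBox : ∀ {C D} → _⊆ᴮ_ π C D → C ⊏ D
  properSubBox {C} {D} C⊆D = (λ {l} l∈C → toContents (C⊆D l (inj₁ (fromContents l∈C))))
                           , bang C , toContents (C⊆D (bang C) (inj₂ (bang-port C)))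
                           , λ bangC∈C → port-out C (bang C) (bang-port C) (fromContents bangC∈C)
    where
      toContents : ∀ {E l} → In π E l → l ∈ˢ contents E
      toContents {E} {l} inE = lookup⇒[]= l (contents E) (trans (lookup∘tabulate (inside E) l) inE)
      fromContents : ∀ {E l} → l ∈ˢ contents E → In π E l
      fromContents {E} {l} l∈E = trans (sym (lookup∘tabulate (inside E) l)) ([]=⇒lookup l∈E)

  In? : ∀ D l → Dec (In π D l)
  In? D l = inside D l Bool.≟ true

  innermost : ∀ {l} D → Acc _⊏_ D → In π D l → ∃ λ X → AtLevel π X l
  innermost {l} D (acc smaller) inD
    with any? (λ C → In? C l ×-dec ¬? (C ≟ D) ×-dec ¬? (In? C (bang D)))
  ... | no noneInside = just D , inD , surrounds
    where
      surrounds : ∀ C → In π C l → C ≡ D ⊎ In π C (bang D)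
      surrounds C inC with C ≟ D | In? C (bang D)
      ... | yes C≡D | _ = inj₁ C≡D
      ... | no _ | yes bangD∈C = inj₂ bangD∈C
      ... | no C≢D | no bangD∉C = ⊥-elim (noneInside (C , inC , C≢D , bangD∉C))
  ... | yes (C , inC , C≢D , bangD∉C) with nesting C D C≢D
  ...   | inj₁ disjoint = ⊥-elim (disjoint l (inj₁ inC) (inj₁ inD))
  ...   | inj₂ (inj₂ D⊆C) = ⊥-elim (bangD∉C (D⊆C (bang D) (inj₂ (bang-port D))))
  ...   | inj₂ (inj₁ C⊆D) = innermost C (smaller (properSubBox C⊆D)) inC

  levelOf : ∀ l → ∃ λ X → AtLevel π X l
  levelOf l with any? (λ D → In? D l)
  ... | no noBox = nothing , λ C inC → noBox (C , inC)
  ... | yes (D , inD) = innermost D (⊏-wellFounded D) inD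

  record CutWith (B : Box) (w : Lk) : Set where
    field
      a c c' : Edge
      es : List Edge
      k : Lk
      ofcB : link (bang B) ≡ ofc a c
      cutK : link k ≡ cut c c' ⊎ link k ≡ cut c' c
      whyW : link w ≡ whynot es c'

    c-src : src c ≡ bang B
    c-src = srcOf ofcB (here refl)

    c'-src : src c' ≡ w
    c'-src = srcOf whyW (here refl)

    c-tgt : tgt c ≡ just k
    c-tgt with cutK
    ... | inj₁ lk = tgtOf lk (here refl)
    ... | inj₂ lk = tgtOf lk (there (here refl))

    c'-tgt : tgt c' ≡ just k
    c'-tgt with cutK
    ... | inj₁ lk = tgtOf lk (there (here refl))
    ... | inj₂ lk = tgtOf lk (here refl)

    k-notSwitched : ¬ Switched (link k)
    k-notSwitched sw with cutK
    ... | inj₁ lk with () ← subst Switched lk sw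
    ... | inj₂ lk with () ← subst Switched lk sw

    k-notPort : ∀ D → ¬ Port π D k
    k-notPort D with cutK
    ... | inj₁ lk = notPort lk (λ ()) (λ ())
    ... | inj₂ lk = notPort lk (λ ()) (λ ())

    w-notPort : ∀ D → ¬ Port π D w
    w-notPort D = notPort whyW (λ ()) (λ ())

    bang∼k : SameBoxes (bang B) k
    bang∼k = subst (λ l → SameBoxes l k) c-src (sameAlongEdge c-tgt k-notPort)

    w∼k : SameBoxes w k
    w∼k = subst (λ l → SameBoxes l k) c'-src (sameAlongEdge c'-tgt k-notPort)

    bang∼w : SameBoxes (bang B) w
    bang∼w = sameBoxes-trans bang∼k (sameBoxes-sym w∼k)

  cut-determines-box : ∀ {B B' w} → CutWith B w → CutWith B' w → B ≡ B'
  cut-determines-box cw cw' = bang-injective (trans (sym (C.c-src)) (trans (cong src c≡) (C'.c-src)))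
    where
      module C = CutWith cw
      module C' = CutWith cw'
      c'≡ : C.c' ≡ C'.c'
      c'≡ = whynot-concl (trans (sym C.whyW) C'.whyW)
      k≡ : C.k ≡ C'.k
      k≡ = just-injective (trans (sym C.c'-tgt) (trans (cong tgt c'≡) C'.c'-tgt))
      c≡ : C.c ≡ C'.c
      c≡ = cut-partner C.cutK cutK'
        where
          cutK' : link C.k ≡ cut C'.c C.c' ⊎ link C.k ≡ cut C.c' C'.c
          cutK' rewrite k≡ | c'≡ = C'.cutK

  record Trace (B C : Box) : Set where
    field
      w p : Lk
      cutW : CutWith B w
      e⁻ e : Edge
      paxP : link p ≡ pax e⁻ e
      portP : Port π C p
      e-tgt : tgt e ≡ just w
    open CutWith cutW public

    e-src : src e ≡ p
    e-src = srcOf paxP (here refl)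

    w∼p : SameBoxes w p
    w∼p = sameBoxes-sym (subst (λ l → SameBoxes l w) e-src (sameAlongEdge e-tgt w-notPort))

    p∼bangC : SameBoxes p (bang C)
    p∼bangC = samePorts portP (bang-port C)

    bang∼bang : SameBoxes (bang B) (bang C)
    bang∼bang = sameBoxes-trans bang∼w (sameBoxes-trans w∼p p∼bangC)

  trace-box : ∀ {B C B' C'} (t : Trace B C) (t' : Trace B' C') → Trace.w t ≡ Trace.w t' → B ≡ B'
  trace-box t t' refl = cut-determines-box (Trace.cutW t) (Trace.cutW t')

  leaveBox : ∀ {C e w ps} → In π C (src e) → ¬ InOrPort π C w → Branch π e w ps → length ps ≤ 1 →
             ∃₂ λ p e' → link p ≡ pax e e' × Port π C p × tgt e' ≡ just w
  leaveBox inC wOutside (reach te _) _ = ⊥-elim (wOutside (boxOut inC te))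
  leaveBox inC wOutside (through {p = p} {c = e'} tp paxP (reach te _)) _ with boxOut inC tp
  ... | inj₂ portP = p , e' , paxP , portP , te
  ... | inj₁ inP = ⊥-elim (wOutside (boxOut (subst (In π _) (sym (srcOf paxP (here refl))) inP) te))
  leaveBox _ _ (through _ _ (through _ _ _)) (s≤s ())

  module Steps (short : ∀ f w ps → ExpBranch π f w ps → length ps ≤ 1) where

    R : Box → Box → Set
    R = _≺₁ᴸ_ π

    traceOf : ∀ {B C} → R B C → Trace B C
    traceOf {B} {C} ((_ , w , (c , c' , (a , ofcB) , (es , whyW) , (k , cutK))
                     , f , ps , f∈C , flatBranch@(_ , cf , flatF , branch)) , bangB∉C) =
      let p , e , paxP , portP , e-tgt = leaveBox cf∈C wOutside branch (short f w ps flatBranch)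
      in record { w = w ; p = p ; cutW = cutW ; e⁻ = cf ; e = e ; paxP = paxP ; portP = portP ; e-tgt = e-tgt }
      where
        cutW : CutWith B w
        cutW = record { a = a ; c = c ; c' = c' ; es = es ; k = k ; ofcB = ofcB ; cutK = cutK ; whyW = whyW }
        cf∈C : In π C (src cf)
        cf∈C = subst (In π C) (sym (srcOf flatF (here refl))) f∈C
        -- w is neither inside C (else so would be bang B) nor a port
        wOutside : ¬ InOrPort π C w
        wOutside (inj₁ w∈C) = bangB∉C (Equivalence.from (CutWith.bang∼w cutW C) w∈C)
        wOutside (inj₂ portW) = CutWith.w-notPort cutW C portW

    -- Arborescence: C determines its pax port, hence e, w and B.

    arborescent : (∀ B l l' → Aux π B l → Aux π B l' → l ≡ l') →
                  ∀ {C B B'} → R B C → R B' C → B ≡ B'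
    arborescent oneAux {C} {B} {B'} r r' = trace-box t t' w≡
      where
        t : Trace B C
        t = traceOf r
        t' : Trace B' C
        t' = traceOf r'
        module T = Trace t
        module T' = Trace t'
        isPaxP : ∀ {l a b} → link l ≡ pax a b → IsPax (link l)
        isPaxP lp = subst IsPax (sym lp) isPax
        p≡ : T.p ≡ T'.p
        p≡ = oneAux _ _ _ (T.portP , isPaxP T.paxP) (T'.portP , isPaxP T'.paxP)
        e≡ : T.e ≡ T'.e
        e≡ = pax-concl (trans (sym T.paxP) (trans (cong link p≡) T'.paxP))
        w≡ : T.w ≡ T'.w
        w≡ = just-injective (trans (sym T.e-tgt) (trans (cong tgt e≡) T'.e-tgt))

    Step : Set
    Step = Σ Box λ B → Σ Box λ C → Trace B C

    key : Step → Box
    key = proj₁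

    wOf : Step → Lk
    wOf (_ , _ , t) = Trace.w t

    eOf : Step → Edge
    eOf (_ , _ , t) = Trace.e t

    edgesOf : Step → List Edge
    edgesOf (_ , _ , t) = Trace.c t ∷ Trace.c' t ∷ Trace.e t ∷ []

    cycleEdges : List Step → List Edge
    cycleEdges [] = []
    cycleEdges (s ∷ ss) = edgesOf s ++ cycleEdges ss

    stepsOf : ∀ {x y} → Star R x y → List Step
    stepsOf ε = []
    stepsOf (_◅_ {x} {y} r P) = (x , y , traceOf r) ∷ stepsOf P

    open SimplePaths _≟_ R using (sources; simpleCycle)

    keys-stepsOf : ∀ {x y} (P : Star R x y) → map key (stepsOf P) ≡ sources P
    keys-stepsOf ε = refl
    keys-stepsOf (r ◅ P) = cong (_ ∷_) (keys-stepsOf P)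

    ∈-cycleEdges : ∀ ss {z} → z ∈ cycleEdges ss → ∃ λ t → t ∈ ss × z ∈ edgesOf t
    ∈-cycleEdges (s ∷ ss) z∈ with ∈-++⁻ (edgesOf s) z∈
    ... | inj₁ z∈s = s , here refl , z∈s
    ... | inj₂ z∈ss with ∈-cycleEdges ss z∈ss
    ...   | t , t∈ss , z∈t = t , there t∈ss , z∈t

    -- Each edge of a trace determines the box the trace starts from:
    -- c, c' and e leave an of-course, a why-not and a pax link respectively.
    module Compare {B C B' C'} (t : Trace B C) (t' : Trace B' C') where
      module T = Trace t
      module T' = Trace t'

      c≡c : T.c ≡ T'.c → B ≡ B'
      c≡c eq = bang-injective (trans (sym T.c-src) (trans (cong src eq) T'.c-src))

      c'≡c' : T.c' ≡ T'.c' → B ≡ B'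
      c'≡c' eq = trace-box t t' (trans (sym T.c'-src) (trans (cong src eq) T'.c'-src))

      e≡e : T.e ≡ T'.e → B ≡ B'
      e≡e eq = trace-box t t' (just-injective (trans (sym T.e-tgt) (trans (cong tgt eq) T'.e-tgt)))

      c≢c' : T.c ≢ T'.c'
      c≢c' = shape-apart T.c-src T'.c'-src T.ofcB T'.whyW (λ ())

      c≢e : T.c ≢ T'.e
      c≢e = shape-apart T.c-src T'.e-src T.ofcB T'.paxP (λ ())

      c'≢e : T.c' ≢ T'.e
      c'≢e = shape-apart T.c'-src T'.e-src T.whyW T'.paxP (λ ())

    edgeOwner : ∀ (s t : Step) {z} → z ∈ edgesOf s → z ∈ edgesOf t → key s ≡ key t
    edgeOwner (_ , _ , t) (_ , _ , t') (here refl) (here q) = Compare.c≡c t t' q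
    edgeOwner (_ , _ , t) (_ , _ , t') (here refl) (there (here q)) = ⊥-elim (Compare.c≢c' t t' q)
    edgeOwner (_ , _ , t) (_ , _ , t') (here refl) (there (there (here q))) = ⊥-elim (Compare.c≢e t t' q)
    edgeOwner (_ , _ , t) (_ , _ , t') (there (here refl)) (here q) = ⊥-elim (Compare.c≢c' t' t (sym q))
    edgeOwner (_ , _ , t) (_ , _ , t') (there (here refl)) (there (here q)) = Compare.c'≡c' t t' q
    edgeOwner (_ , _ , t) (_ , _ , t') (there (here refl)) (there (there (here q))) =
      ⊥-elim (Compare.c'≢e t t' q)
    edgeOwner (_ , _ , t) (_ , _ , t') (there (there (here refl))) (here q) = ⊥-elim (Compare.c≢e t' t (sym q))
    edgeOwner (_ , _ , t) (_ , _ , t') (there (there (here refl))) (there (here q)) =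
      ⊥-elim (Compare.c'≢e t' t (sym q))
    edgeOwner (_ , _ , t) (_ , _ , t') (there (there (here refl))) (there (there (here q))) = Compare.e≡e t t' q

    cycleEdges-unique : ∀ ss → Unique (map key ss) → Unique (cycleEdges ss)
    cycleEdges-unique [] _ = []
    cycleEdges-unique (s@(_ , _ , t) ∷ ss) (s∉ss ∷ unique) =
      ++⁺ ((c≢c' ∷ c≢e ∷ []) ∷ (c'≢e ∷ []) ∷ [] ∷ []) (cycleEdges-unique ss unique) apart
      where
        open Compare t t
        apart : ∀ {z} → ¬ (z ∈ edgesOf s × z ∈ cycleEdges ss)
        apart (z∈s , z∈ss) with ∈-cycleEdges ss z∈ss
        ... | u , u∈ss , z∈u = All.lookup s∉ss (∈-map⁺ key u∈ss) (edgeOwner s u z∈s z∈u)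

    -- The switching: at each link keep the premise e of the trace through
    -- it if there is one, and the first premise otherwise.

    chosen : List Step → Lk → Maybe Edge
    chosen [] l = head (prem (link l))
    chosen (s ∷ ss) l with wOf s ≟ l
    ... | yes _ = just (eOf s)
    ... | no _ = chosen ss l

    chosen-prem : ∀ ss l {e} → e ∈ prem (link l) → ∃ λ e' → chosen ss l ≡ just e' × e' ∈ prem (link l)
    chosen-prem [] l e∈ = head-∈ e∈
    chosen-prem ((_ , _ , t) ∷ ss) l e∈ with Trace.w t ≟ l
    ... | yes refl = Trace.e t , refl , tgt⇒prem (Trace.e-tgt t)
    ... | no _ = chosen-prem ss l e∈

    chosen-trace : ∀ {ss t} → Unique (map key ss) → t ∈ ss → chosen ss (wOf t) ≡ just (eOf t)
    chosen-trace {s ∷ _} _ (here refl) with wOf s ≟ wOf s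
    ... | yes _ = refl
    ... | no w≢w = ⊥-elim (w≢w refl)
    chosen-trace {s@(_ , _ , u) ∷ ss} {t@(_ , _ , v)} (s∉ss ∷ unique) (there t∈ss) with wOf s ≟ wOf t
    ... | yes w≡ = ⊥-elim (All.lookup s∉ss (∈-map⁺ key t∈ss) (trace-box u v w≡))
    ... | no _ = chosen-trace unique t∈ss

    module Switching (ss : List Step) where

      _≟ₘ_ : DecidableEquality (Maybe Edge)
      _≟ₘ_ = Maybe.≡-dec _≟_

      kept : Edge → Bool
      kept e = does ((tgt e >>= chosen ss) ≟ₘ just e)

      kept-true : ∀ {e l} → tgt e ≡ just l → chosen ss l ≡ just e → kept e ≡ true
      kept-true te ch = dec-true (_ ≟ₘ _) (trans (cong (_>>= chosen ss) te) ch)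

      kept-chosen : ∀ {e l} → tgt e ≡ just l → kept e ≡ true → chosen ss l ≡ just e
      kept-chosen te k = trans (sym (cong (_>>= chosen ss) te)) (does-true⇒ (_ ≟ₘ _) k)

      valid : ValidSwitching π kept
      valid l _ = atLeastOne , atMostOne
        where
          atLeastOne : (∃ λ e → e ∈ prem (link l)) → ∃ λ e → e ∈ prem (link l) × kept e ≡ true
          atLeastOne (_ , e∈) with chosen-prem ss l e∈
          ... | e' , ch , e'∈ = e' , e'∈ , kept-true (prem⇒tgt e'∈) ch
          atMostOne : ∀ e e' → e ∈ prem (link l) → e' ∈ prem (link l) → kept e ≡ true → kept e' ≡ true → e ≡ e'
          atMostOne e e' e∈ e'∈ k k' =
            just-injective (trans (sym (kept-chosen (prem⇒tgt e∈) k)) (kept-chosen (prem⇒tgt e'∈) k'))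

    -- A path of steps, all of whose links are at level X, is a walk
    -- B₀ –c– k –c'– w –e– B₁ – ⋯ in the graph of level X.

    module CycleWalk (X : Maybe Box) (kept : Edge → Bool) (l₀ : Lk) (atX : AtLevel π X l₀) where

      at : ∀ {l} → SameBoxes l₀ l → AtLevel π X l
      at s = atLevel-resp X s atX

      repPort : ∀ {D l} → Port π D l → rep π l ≡ inj₂ D
      repPort {D} {l} port = cong (maybe inj₂ (inj₁ l)) port

      walk : ∀ {x y} (P : Star R x y) → SameBoxes l₀ (bang x) →
             (∀ {t} → t ∈ stepsOf P → kept (eOf t) ≡ true) →
             Walk (LevelStep π X kept) (inj₂ x) (inj₂ y) (cycleEdges (stepsOf P))
      walk ε _ _ = []
      walk {x} (_◅_ {j = y} r P) l₀∼x eKept = cStep ∷ c'Step ∷ eStep ∷ walk P l₀∼y (λ t∈ → eKept (there t∈))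
        where
          open Trace (traceOf r)
          l₀∼k : SameBoxes l₀ k
          l₀∼k = sameBoxes-trans l₀∼x bang∼k
          l₀∼w : SameBoxes l₀ w
          l₀∼w = sameBoxes-trans l₀∼x bang∼w
          l₀∼p : SameBoxes l₀ p
          l₀∼p = sameBoxes-trans l₀∼w w∼p
          l₀∼y : SameBoxes l₀ (bang y)
          l₀∼y = sameBoxes-trans l₀∼p p∼bangC
          at-src : ∀ {e l} → src e ≡ l → SameBoxes l₀ l → AtLevel π X (src e)
          at-src refl s = at s
          cStep : LevelStep π X kept c (inj₂ x) (rep π k)
          cStep = k , c-tgt , at-src c-src l₀∼x , at l₀∼k , (λ sw → ⊥-elim (k-notSwitched sw))
                , inj₁ (trans (cong (rep π) c-src) (repPort (bang-port x)) , refl)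
          c'Step : LevelStep π X kept c' (rep π k) (rep π w)
          c'Step = k , c'-tgt , at-src c'-src l₀∼w , at l₀∼k , (λ sw → ⊥-elim (k-notSwitched sw))
                 , inj₂ (cong (rep π) c'-src , refl)
          eStep : LevelStep π X kept e (rep π w) (inj₂ y)
          eStep = w , e-tgt , at-src e-src l₀∼p , at l₀∼w , (λ _ → eKept (here refl))
                , inj₂ (trans (cong (rep π) e-src) (repPort portP) , refl)

    noCycle : DanosRegnier π → ∀ {x y} → R x y → Star R y x → ⊥
    noCycle acyclic {x} {y} r P =
      acyclic X kept valid (inj₂ x) _ _ (CycleWalk.walk X kept (bang x) atX (r ◅ Q) sameBoxes-refl eKept)
              (cycleEdges-unique steps uniqueKeys)
      where
        X : Maybe Box
        X = proj₁ (levelOf (bang x))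
        atX : AtLevel π X (bang x)
        atX = proj₂ (levelOf (bang x))
        Q : Star R y x
        Q = proj₁ (simpleCycle r P)
        steps : List Step
        steps = stepsOf (r ◅ Q)
        uniqueKeys : Unique (map key steps)
        uniqueKeys = subst Unique (sym (keys-stepsOf (r ◅ Q))) (proj₂ (simpleCycle r P))
        open Switching steps
        eKept : ∀ {t} → t ∈ steps → kept (eOf t) ≡ true
        eKept {_ , _ , t} t∈ = kept-true (Trace.e-tgt t) (chosen-trace uniqueKeys t∈)


mainTheorem17 : (π : PreStructure) → mL⁴ π →
    IsPartialOrder _≡_ (_⪯ᴸ_ π)
    × (∀ (C B B' : Fin (PreStructure.nB π)) → _≺₁ᴸ_ π B C → _≺₁ᴸ_ π B' C → B ≡ B')
mainTheorem17 π (((wf , acyclic) , _) , oneAux , short) = partialOrder , λ C B B' → arborescent oneAux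
  where
    open ProofStructure π wf
    open Steps short
    antisym : ∀ {x y} → Star R x y → Star R y x → x ≡ y
    antisym ε _ = refl
    antisym (r ◅ P) Q = ⊥-elim (noCycle acyclic r (P ◅◅ Q))
    partialOrder : IsPartialOrder _≡_ (_⪯ᴸ_ π)
    partialOrder = record
      { isPreorder = record { isEquivalence = isEquivalence ; reflexive = λ { refl → ε } ; trans = _◅◅_ }
      ; antisym = antisym }
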